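{- Let $\mathbf{A}$ be a relational structure and $k\geq1$. If $\mathbf{A}$ is $(k+1)$-polymorphism-homogeneous, then it is $k$-polymorphism-homogeneous.
   Context: $\mathbf{A}^k$ is the direct power of $\mathbf{A}$ (carrier $A^k$, relations defined coordinatewise). A $k$-ary polymorphism of $\mathbf{A}$ is a homomorphism $\mathbf{A}^k\to\mathbf{A}$; a $k$-ary local polymorphism is a homomorphism from a finite induced substructure of $\mathbf{A}^k$ to $\mathbf{A}$. $\mathbf{A}$ is $k$-polymorphism-homogeneous if every $k$-ary local polymorphism extends to a $k$-ary polymorphism. -}

module Defs where

open import Data.Nat using (ℕ)
open import Data.Fin using (Fin)
open import Data.Vec using (Vec; map; lookup)
open import Data.List using (List)
open import Data.List.Membership.Propositional using (_∈_)
open import Data.Product using (_×_; proj₁; proj₂; Σ)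
open import Relation.Binary.PropositionalEquality using (_≡_)

record Structure : Set₁ where
  field
    Carrier : Set
    Sym     : Set
    arity   : Sym → ℕ
    Rel     : (s : Sym) → Vec Carrier (arity s) → Set
open Structure public

-- Elements of the power A^k are k-tuples (Vec A k).
-- A tuple t of elements of A^k lies in the (coordinatewise) relation R_s of A^k.
RelPow : (A : Structure) (k : ℕ) (s : Sym A) → Vec (Vec (Carrier A) k) (arity A s) → Set
RelPow A k s t = (j : Fin k) → Rel A s (map (λ x → lookup x j) t)

IsPolymorphism : (A : Structure) (k : ℕ) → (Vec (Carrier A) k → Carrier A) → Set
IsPolymorphism A k g =
  (s : Sym A) (t : Vec (Vec (Carrier A) k) (arity A s)) → RelPow A k s t → Rel A s (map g t)

-- A finite partial map A^k ⇀ A given by its graph (a finite list of pairs),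
-- required to be functional.
Graph : (A : Structure) (k : ℕ) → Set
Graph A k = List (Vec (Carrier A) k × Carrier A)

IsFunctional : (A : Structure) (k : ℕ) → Graph A k → Set
IsFunctional A k L = (p q : Vec (Carrier A) k × Carrier A) → p ∈ L → q ∈ L →
  proj₁ p ≡ proj₁ q → proj₂ p ≡ proj₂ q

-- k-ary local polymorphism: a homomorphism from the finite induced substructure
-- of A^k on the domain of L to A.
IsLocalPolymorphism : (A : Structure) (k : ℕ) → Graph A k → Set
IsLocalPolymorphism A k L =
  IsFunctional A k L ×
  ((s : Sym A) (t : Vec (Vec (Carrier A) k × Carrier A) (arity A s)) →
     ((i : Fin (arity A s)) → lookup t i ∈ L) →
     RelPow A k s (map proj₁ t) → Rel A s (map proj₂ t))

Extends : (A : Structure) (k : ℕ) → (Vec (Carrier A) k → Carrier A) → Graph A k → Set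
Extends A k g L = (p : Vec (Carrier A) k × Carrier A) → p ∈ L → g (proj₁ p) ≡ proj₂ p

PolymorphismHomogeneous : (k : ℕ) (A : Structure) → Set
PolymorphismHomogeneous k A =
  (L : Graph A k) → IsLocalPolymorphism A k L →
  Σ (Vec (Carrier A) k → Carrier A) λ g → IsPolymorphism A k g × Extends A k g L

-- A^k is a retract of A^(k+1): duplicating the first coordinate and dropping it again are
-- homomorphisms whose composite is the identity. Homogeneity passes to retracts: pull a local
-- polymorphism back along the retraction, extend it, and restrict the extension along the section.

module Submission where

open import Defs
open import Data.Nat using (ℕ; suc; _≤_; s≤s; z≤n)
open import Data.Fin using (Fin; zero; suc)
open import Data.Vec using (Vec; map; lookup; tabulate)
open import Data.Vec.Properties using (map-∘; map-cong; lookup-map; lookup∘tabulate; tabulate∘lookup; tabulate-cong)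
import Data.List as List
open import Data.List.Membership.Propositional using (_∈_)
open import Data.List.Membership.Propositional.Properties using (∈-map⁺; ∈-map⁻)
open import Data.Product using (_×_; _,_; proj₁; proj₂; Σ; map₁)
open import Function using (_∘_)
open import Relation.Binary.PropositionalEquality
  using (_≡_; refl; sym; trans; cong; subst; module ≡-Reasoning)

IsPowerHomomorphism : (A : Structure) (n m : ℕ) → (Vec (Carrier A) n → Vec (Carrier A) m) → Set
IsPowerHomomorphism A n m h =
  (s : Sym A) (t : Vec (Vec (Carrier A) n) (arity A s)) → RelPow A n s t → RelPow A m s (map h t)

module _ (A : Structure) where

  private
    C = Carrier A

  polymorphism-∘ : ∀ {n m} {g : Vec C m → C} {h : Vec C n → Vec C m} →
    IsPolymorphism A m g → IsPowerHomomorphism A n m h → IsPolymorphism A n (g ∘ h)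
  polymorphism-∘ {g = g} {h} g-pol h-hom s t r =
    subst (Rel A s) (sym (map-∘ g h t)) (g-pol s (map h t) (h-hom s t r))

  homogeneous-retract : ∀ {n m} (e : Vec C n → Vec C m) (r : Vec C m → Vec C n) →
    IsPowerHomomorphism A n m e → IsPowerHomomorphism A m n r → (∀ x → r (e x) ≡ x) →
    PolymorphismHomogeneous m A → PolymorphismHomogeneous n A
  homogeneous-retract {n} {m} e r e-hom r-hom r∘e H L (L-fun , L-hom) =
    g' ∘ e , polymorphism-∘ g'-pol e-hom , g-ext
    where
    L' : Graph A m
    L' = List.map (map₁ e) L

    L'-fun : IsFunctional A m L'
    L'-fun p q p∈ q∈ ep≡eq with ∈-map⁻ (map₁ e) p∈ | ∈-map⁻ (map₁ e) q∈
    ... | (x , a) , xa∈ , refl | (y , b) , yb∈ , refl =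
      L-fun (x , a) (y , b) xa∈ yb∈ (trans (sym (r∘e x)) (trans (cong r ep≡eq) (r∘e y)))

    retract-∈ : (p : Vec C m × C) → p ∈ L' → map₁ r p ∈ L
    retract-∈ p p∈ with ∈-map⁻ (map₁ e) p∈
    ... | (x , a) , xa∈ , refl = subst (λ y → (y , a) ∈ L) (sym (r∘e x)) xa∈

    L'-hom : (s : Sym A) (t : Vec (Vec C m × C) (arity A s)) →
      ((i : Fin (arity A s)) → lookup t i ∈ L') →
      RelPow A m s (map proj₁ t) → Rel A s (map proj₂ t)
    L'-hom s t t∈ rel = subst (Rel A s) (sym (map-∘ proj₂ (map₁ r) t)) (L-hom s (map (map₁ r) t) t'∈ rel')
      where
      t'∈ : (i : Fin (arity A s)) → lookup (map (map₁ r) t) i ∈ L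
      t'∈ i = subst (_∈ L) (sym (lookup-map i (map₁ r) t)) (retract-∈ (lookup t i) (t∈ i))

      rel' : RelPow A n s (map proj₁ (map (map₁ r) t))
      rel' = subst (RelPow A n s) (trans (sym (map-∘ r proj₁ t)) (map-∘ proj₁ (map₁ r) t))
               (r-hom s (map proj₁ t) rel)

    extension : Σ (Vec C m → C) λ g → IsPolymorphism A m g × Extends A m g L'
    extension = H L' (L'-fun , L'-hom)

    g' : Vec C m → C
    g' = proj₁ extension

    g'-pol : IsPolymorphism A m g'
    g'-pol = proj₁ (proj₂ extension)

    g-ext : Extends A n (g' ∘ e) L
    g-ext p p∈ = proj₂ (proj₂ extension) (map₁ e p) (∈-map⁺ (map₁ e) p∈)

  select : ∀ {n m} → (Fin m → Fin n) → Vec C n → Vec C m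
  select σ x = tabulate (λ j → lookup x (σ j))

  select-isPowerHomomorphism : ∀ {n m} (σ : Fin m → Fin n) → IsPowerHomomorphism A n m (select σ)
  select-isPowerHomomorphism σ s t r j = subst (Rel A s) coordinate (r (σ j))
    where
    open ≡-Reasoning
    coordinate : map (λ x → lookup x (σ j)) t ≡ map (λ x → lookup x j) (map (select σ) t)
    coordinate = begin
      map (λ x → lookup x (σ j)) t           ≡⟨ map-cong (λ x → sym (lookup∘tabulate _ j)) t ⟩
      map (λ x → lookup (select σ x) j) t    ≡⟨ map-∘ (λ x → lookup x j) (select σ) t ⟩
      map (λ x → lookup x j) (map (select σ) t) ∎

  select-section : ∀ {n m} (σ : Fin m → Fin n) (τ : Fin n → Fin m) → (∀ i → σ (τ i) ≡ i) →
    ∀ x → select τ (select σ x) ≡ x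
  select-section σ τ σ∘τ x = begin
    tabulate (λ i → lookup (select σ x) (τ i)) ≡⟨ tabulate-cong (λ i → lookup∘tabulate _ (τ i)) ⟩
    tabulate (λ i → lookup x (σ (τ i)))        ≡⟨ tabulate-cong (λ i → cong (lookup x) (σ∘τ i)) ⟩
    tabulate (lookup x)                        ≡⟨ tabulate∘lookup x ⟩
    x ∎
    where open ≡-Reasoning

  homogeneous-surjection : ∀ {n m} (σ : Fin m → Fin n) (τ : Fin n → Fin m) → (∀ i → σ (τ i) ≡ i) →
    PolymorphismHomogeneous m A → PolymorphismHomogeneous n A
  homogeneous-surjection σ τ σ∘τ =
    homogeneous-retract (select σ) (select τ)
      (select-isPowerHomomorphism σ) (select-isPowerHomomorphism τ) (select-section σ τ σ∘τ)

duplicateZero : ∀ {n} → Fin (suc (suc n)) → Fin (suc n)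
duplicateZero zero    = zero
duplicateZero (suc i) = i

mainTheorem11 : (A : Structure) (k : ℕ) → 1 ≤ k →
    PolymorphismHomogeneous (suc k) A → PolymorphismHomogeneous k A
mainTheorem11 A (suc k) (s≤s z≤n) = homogeneous-surjection A duplicateZero suc (λ i → refl)
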